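{- Let $(G^A_n)_{n\in\mathbb{N}}$ and $(G^B_n)_{n\in\mathbb{N}}$ be bi-iteratively constructible families of graphs. Then the family $(G^A_n\sqcup G^B_n)_{n\in\mathbb{N}}$ obtained by taking disjoint unions is bi-iteratively constructible. In particular, if both $(G^A_n)$ and $(G^B_n)$ are iteratively constructible, then so is $(G^A_n\sqcup G^B_n)$.
   Context: A $k$-graph is $G=(V,E;R_1,\ldots,R_k)$ with $(V,E)$ a finite simple graph and labels $R_1,\ldots,R_k\subseteq V$ partitioning $V$. Basic operations on $k$-graphs: $Add_i$ (add a new vertex to $R_i$); $\rho_{i\to j}$ (move all vertices of $R_i$ into $R_j$, leaving $R_i$ empty); $\eta_{i,j}$ (add all edges between vertices labeled $i$ and vertices labeled $j$); $\eta^b_{i,j}$ (equal to $\eta_{i,j}$ if $|R_i\cup R_j|\leq b$, otherwise the identity); $\delta_{i,j}$ (remove all edges between vertices labeled $i$ and $j$). An elementary operation is a finite composition of basic operations. For a $k$-graph $G_0$ and elementary operation $F$, the $F$-iteration family is $G_{n+1}=F(G_n)$; for elementary operations $H,F,L$, an $(H,F,L)$-bi-iteration family is given by $G_{n+1}=H(F^n(L(G_n)))$. A family of graphs $(G_n)$ is iteratively (resp. bi-iteratively) constructible if for some $k$ there is an iteration (resp. bi-iteration) family of $k$-graphs whose underlying graphs, ignoring labels, are the $G_n$. -}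

module Defs where

open import Data.Nat using (ℕ; zero; suc; _+_; _≤_; _≤?_)
open import Data.Fin using (Fin; zero; suc; splitAt; _≟_)
open import Data.Bool using (Bool; true; false; _∧_; _∨_; not; if_then_else_)
open import Data.Bool.Properties using (∨-comm; ∧-comm; ∧-zeroʳ; ∨-identityʳ)
open import Data.Sum using (_⊎_; inj₁; inj₂)
open import Data.Product using (Σ; ∃; _×_; _,_)
open import Data.List using (List; []; _∷_)
open import Data.Empty using (⊥-elim)
open import Relation.Nullary using (yes; no)
open import Relation.Nullary.Decidable using (⌊_⌋)
open import Relation.Binary.PropositionalEquality using (_≡_; refl; sym; trans; cong; cong₂)
open import Function.Bundles using (_↔_; Inverse)

record Graph : Set where
  field
    size   : ℕ
    adj    : Fin size → Fin size → Bool
    adjSym : ∀ u v → adj u v ≡ adj v u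
    adjIrr : ∀ u → adj u u ≡ false
open Graph public

record _≅_ (G H : Graph) : Set where
  field
    bij      : Fin (size G) ↔ Fin (size H)
    preserve : ∀ u v → adj H (Inverse.to bij u) (Inverse.to bij v) ≡ adj G u v

private
  adj⊎ : ∀ {m n} → (Fin m → Fin m → Bool) → (Fin n → Fin n → Bool)
       → Fin m ⊎ Fin n → Fin m ⊎ Fin n → Bool
  adj⊎ a b (inj₁ x) (inj₁ y) = a x y
  adj⊎ a b (inj₂ x) (inj₂ y) = b x y
  adj⊎ a b (inj₁ x) (inj₂ y) = false
  adj⊎ a b (inj₂ x) (inj₁ y) = false

  adj⊎-sym : ∀ {m n} (a : Fin m → Fin m → Bool) (b : Fin n → Fin n → Bool)
    → (∀ u v → a u v ≡ a v u) → (∀ u v → b u v ≡ b v u)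
    → ∀ x y → adj⊎ a b x y ≡ adj⊎ a b y x
  adj⊎-sym a b sa sb (inj₁ x) (inj₁ y) = sa x y
  adj⊎-sym a b sa sb (inj₂ x) (inj₂ y) = sb x y
  adj⊎-sym a b sa sb (inj₁ x) (inj₂ y) = refl
  adj⊎-sym a b sa sb (inj₂ x) (inj₁ y) = refl

  adj⊎-irr : ∀ {m n} (a : Fin m → Fin m → Bool) (b : Fin n → Fin n → Bool)
    → (∀ u → a u u ≡ false) → (∀ u → b u u ≡ false)
    → ∀ x → adj⊎ a b x x ≡ false
  adj⊎-irr a b ia ib (inj₁ x) = ia x
  adj⊎-irr a b ia ib (inj₂ x) = ib x

_⊔_ : Graph → Graph → Graph
G ⊔ H = record
  { size   = size G + size H
  ; adj    = λ u v → adj⊎ (adj G) (adj H) (splitAt (size G) u) (splitAt (size G) v)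
  ; adjSym = λ u v → adj⊎-sym (adj G) (adj H) (adjSym G) (adjSym H)
                       (splitAt (size G) u) (splitAt (size G) v)
  ; adjIrr = λ u → adj⊎-irr (adj G) (adj H) (adjIrr G) (adjIrr H) (splitAt (size G) u)
  }

-- k-graphs: a graph with a labelling V → Fin k (the labels R_i = label⁻¹(i)
-- partition V, possibly with empty parts).

record KGraph (k : ℕ) : Set where
  field
    graph : Graph
    label : Fin (size graph) → Fin k
open KGraph public

private
  eqB : ∀ {n} → Fin n → Fin n → Bool
  eqB u v = ⌊ u ≟ v ⌋

  eqB-sym : ∀ {n} (u v : Fin n) → eqB u v ≡ eqB v u
  eqB-sym u v with u ≟ v | v ≟ u
  ... | yes _ | yes _ = refl
  ... | no _  | no _  = refl
  ... | yes p | no q  = ⊥-elim (q (sym p))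
  ... | no p  | yes q = ⊥-elim (p (sym q))

  eqB-diag : ∀ {n} (u : Fin n) → eqB u u ≡ true
  eqB-diag u with u ≟ u
  ... | yes _ = refl
  ... | no p  = ⊥-elim (p refl)

  cross : ∀ {k n} → (Fin n → Fin k) → Fin k → Fin k → Fin n → Fin n → Bool
  cross ℓ i j u v = (eqB (ℓ u) i ∧ eqB (ℓ v) j) ∨ (eqB (ℓ u) j ∧ eqB (ℓ v) i)

  cross-sym : ∀ {k n} (ℓ : Fin n → Fin k) i j u v → cross ℓ i j u v ≡ cross ℓ i j v u
  cross-sym ℓ i j u v =
    trans (∨-comm (eqB (ℓ u) i ∧ eqB (ℓ v) j) (eqB (ℓ u) j ∧ eqB (ℓ v) i))
          (cong₂ _∨_ (∧-comm (eqB (ℓ u) j) (eqB (ℓ v) i)) (∧-comm (eqB (ℓ u) i) (eqB (ℓ v) j)))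

  addEdges : (G : Graph) (P : Fin (size G) → Fin (size G) → Bool)
           → (∀ u v → P u v ≡ P v u) → Graph
  addEdges G P Ps = record
    { size   = size G
    ; adj    = λ u v → adj G u v ∨ (P u v ∧ not (eqB u v))
    ; adjSym = λ u v → cong₂ _∨_ (adjSym G u v) (cong₂ _∧_ (Ps u v) (cong not (eqB-sym u v)))
    ; adjIrr = λ u → trans (cong₂ _∨_ (adjIrr G u) (cong (λ b → P u u ∧ not b) (eqB-diag u)))
                           (∧-zeroʳ (P u u))
    }

  removeEdges : (G : Graph) (P : Fin (size G) → Fin (size G) → Bool)
              → (∀ u v → P u v ≡ P v u) → Graph
  removeEdges G P Ps = record
    { size   = size G
    ; adj    = λ u v → adj G u v ∧ not (P u v)
    ; adjSym = λ u v → cong₂ _∧_ (adjSym G u v) (cong not (Ps u v))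
    ; adjIrr = λ u → cong (λ b → b ∧ not (P u u)) (adjIrr G u)
    }

  addVertexAdj : ∀ {n} → (Fin n → Fin n → Bool) → Fin (suc n) → Fin (suc n) → Bool
  addVertexAdj a zero    _       = false
  addVertexAdj a (suc u) zero    = false
  addVertexAdj a (suc u) (suc v) = a u v

  addVertexLabel : ∀ {k n} → Fin k → (Fin n → Fin k) → Fin (suc n) → Fin k
  addVertexLabel i ℓ zero    = i
  addVertexLabel i ℓ (suc v) = ℓ v

countFin : ∀ {n} → (Fin n → Bool) → ℕ
countFin {zero}  p = 0
countFin {suc n} p = (if p zero then 1 else 0) + countFin (λ v → p (suc v))

sizeLabels : ∀ {k} → KGraph k → Fin k → Fin k → ℕ
sizeLabels G i j = countFin (λ v → eqB (label G v) i ∨ eqB (label G v) j)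

Add : ∀ {k} → Fin k → KGraph k → KGraph k
Add i G = record
  { graph = record
      { size   = suc (size (graph G))
      ; adj    = addVertexAdj (adj (graph G))
      ; adjSym = s
      ; adjIrr = r
      }
  ; label = addVertexLabel i (label G)
  }
  where
    s : ∀ u v → addVertexAdj (adj (graph G)) u v ≡ addVertexAdj (adj (graph G)) v u
    s zero zero = refl
    s zero (suc v) = refl
    s (suc u) zero = refl
    s (suc u) (suc v) = adjSym (graph G) u v
    r : ∀ u → addVertexAdj (adj (graph G)) u u ≡ false
    r zero = refl
    r (suc u) = adjIrr (graph G) u

ρ : ∀ {k} → Fin k → Fin k → KGraph k → KGraph k
ρ i j G = record
  { graph = graph G
  ; label = λ v → if eqB (label G v) i then j else label G v
  }

-- η_{i,j} : add all edges between label-i and label-j vertices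
-- (no loops: for i = j this makes R_i a clique).
η : ∀ {k} → Fin k → Fin k → KGraph k → KGraph k
η i j G = record
  { graph = addEdges (graph G) (cross (label G) i j) (cross-sym (label G) i j)
  ; label = label G
  }

ηᵇ : ∀ {k} → ℕ → Fin k → Fin k → KGraph k → KGraph k
ηᵇ b i j G with sizeLabels G i j ≤? b
... | yes _ = η i j G
... | no  _ = G

δ : ∀ {k} → Fin k → Fin k → KGraph k → KGraph k
δ i j G = record
  { graph = removeEdges (graph G) (cross (label G) i j) (cross-sym (label G) i j)
  ; label = label G
  }

data BasicOp (k : ℕ) : Set where
  opAdd : Fin k → BasicOp k
  opρ   : Fin k → Fin k → BasicOp k
  opη   : Fin k → Fin k → BasicOp k
  opηᵇ  : ℕ → Fin k → Fin k → BasicOp k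
  opδ   : Fin k → Fin k → BasicOp k

applyBasic : ∀ {k} → BasicOp k → KGraph k → KGraph k
applyBasic (opAdd i)    = Add i
applyBasic (opρ i j)    = ρ i j
applyBasic (opη i j)    = η i j
applyBasic (opηᵇ b i j) = ηᵇ b i j
applyBasic (opδ i j)    = δ i j

-- Elementary operations: finite compositions of basic operations.
-- The list o₁ ∷ o₂ ∷ … ∷ oₘ ∷ [] denotes o₁ ∘ o₂ ∘ … ∘ oₘ.
ElemOp : ℕ → Set
ElemOp k = List (BasicOp k)

apply : ∀ {k} → ElemOp k → KGraph k → KGraph k
apply []       G = G
apply (o ∷ os) G = applyBasic o (apply os G)

iter : ∀ {A : Set} → (A → A) → ℕ → A → A
iter f zero    x = x
iter f (suc n) x = f (iter f n x)

iterFamily : ∀ {k} → ElemOp k → KGraph k → ℕ → KGraph k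
iterFamily F G₀ n = iter (apply F) n G₀

biIterFamily : ∀ {k} → ElemOp k → ElemOp k → ElemOp k → KGraph k → ℕ → KGraph k
biIterFamily H F L G₀ zero    = G₀
biIterFamily H F L G₀ (suc n) =
  apply H (iter (apply F) n (apply L (biIterFamily H F L G₀ n)))

IterativelyConstructible : (ℕ → Graph) → Set
IterativelyConstructible G =
  Σ ℕ λ k → Σ (KGraph k) λ G₀ → Σ (ElemOp k) λ F →
    ∀ n → graph (iterFamily F G₀ n) ≅ G n

BiIterativelyConstructible : (ℕ → Graph) → Set
BiIterativelyConstructible G =
  Σ ℕ λ k → Σ (KGraph k) λ G₀ → Σ (ElemOp k) λ H → Σ (ElemOp k) λ F → Σ (ElemOp k) λ L →
    ∀ n → graph (biIterFamily H F L G₀ n) ≅ G n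

-- Run the two constructions side by side on disjoint sets of labels: the
-- labels of A are embedded into Fin (kA + kB) by _↑ˡ kB, those of B by kA ↑ʳ_,
-- and each pair of elementary operations is replaced by the composite of their
-- copies.  An operation on A-labels acts on the combined k-graph exactly as on
-- the A-part and leaves the B-part untouched; for η^b this holds because
-- |R_i ∪ R_j| counts only A-vertices.  So at every stage the combined k-graph
-- is the disjoint union of the two, up to an interleaving of the vertices.

module Submission where

open import Defs
open import Algebra.Properties.CommutativeSemigroup using (x∙yz≈y∙xz)
open import Data.Bool using (Bool; true; false; _∧_; _∨_; not; if_then_else_)
open import Data.Bool.Properties using (∧-zeroʳ; ∧-identityʳ; ∨-identityʳ; if-float)
open import Data.Empty using (⊥-elim)
open import Data.Fin using (Fin; zero; suc; splitAt; join; _≟_; _↑ˡ_; _↑ʳ_)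
open import Data.Fin.Properties using (↑ˡ-injective; ↑ʳ-injective; splitAt-↑ˡ; splitAt-↑ʳ; splitAt-join; +↔⊎)
open import Data.List using (_∷_; []; _++_; map)
open import Data.Nat using (ℕ; zero; suc; _+_; _≤_; _≤?_)
open import Data.Nat.Properties using (+-assoc; +-identityʳ; +-commutativeSemigroup)
open import Data.Product using (_×_; _,_)
open import Data.Sum as Sum using (_⊎_; inj₁; inj₂)
open import Data.Sum.Function.Propositional using (_⊎-↔_)
open import Data.Sum.Properties using ([,]-map; inj₁-injective) renaming (≡-dec to ⊎-≡-dec)
open import Function using (_∘_; _↔_; Inverse; mk↔ₛ′; mk⇔)
open import Function.Definitions using (Injective)
open import Function.Properties.Inverse using (↔-trans; ↔-sym)
open import Relation.Binary.Definitions using (DecidableEquality)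
open import Relation.Binary.PropositionalEquality
open import Relation.Nullary using (does; yes; no)
open import Relation.Nullary.Decidable using (⌊_⌋; does-⇔; dec-false; isYes≗does)

⌊≟⌋-injective : {A B : Set} {f : A → B} → Injective _≡_ _≡_ f →
  (_≟A_ : DecidableEquality A) (_≟B_ : DecidableEquality B) →
  ∀ x y → ⌊ f x ≟B f y ⌋ ≡ ⌊ x ≟A y ⌋
⌊≟⌋-injective {f = f} f-inj _≟A_ _≟B_ x y = begin
  ⌊ f x ≟B f y ⌋    ≡⟨ isYes≗does (f x ≟B f y) ⟩
  does (f x ≟B f y) ≡⟨ does-⇔ (mk⇔ f-inj (cong f)) (f x ≟B f y) (x ≟A y) ⟩
  does (x ≟A y)     ≡⟨ isYes≗does (x ≟A y) ⟨
  ⌊ x ≟A y ⌋        ∎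
  where open ≡-Reasoning

⌊≟⌋-≢ : {A : Set} (_≟A_ : DecidableEquality A) {x y : A} → x ≢ y → ⌊ x ≟A y ⌋ ≡ false
⌊≟⌋-≢ _≟A_ {x} {y} x≢y = trans (isYes≗does (x ≟A y)) (dec-false (x ≟A y) x≢y)

-- _≡ᵇ_ and linked unfold to the private eqB and cross through which Defs
-- defines η and δ.

_≡ᵇ_ : ∀ {n} → Fin n → Fin n → Bool
u ≡ᵇ v = ⌊ u ≟ v ⌋

_≟₊_ : ∀ {a b} → DecidableEquality (Fin a ⊎ Fin b)
_≟₊_ = ⊎-≡-dec _≟_ _≟_

linked : {V : Set} → (V → Bool) → (V → Bool) → V → V → Bool
linked P Q u v = (P u ∧ Q v) ∨ (Q u ∧ P v)

linked-cong : {V W : Set} {P Q : V → Bool} (P′ Q′ : W → Bool) (f : V → W) →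
  (∀ u → P u ≡ P′ (f u)) → (∀ u → Q u ≡ Q′ (f u)) →
  ∀ u v → linked P Q u v ≡ linked P′ Q′ (f u) (f v)
linked-cong P′ Q′ f P≡ Q≡ u v =
  cong₂ _∨_ (cong₂ _∧_ (P≡ u) (Q≡ v)) (cong₂ _∧_ (Q≡ u) (P≡ v))

countFin-cong : ∀ {n} {p q : Fin n → Bool} → (∀ v → p v ≡ q v) → countFin p ≡ countFin q
countFin-cong {zero}  p≡q = refl
countFin-cong {suc n} p≡q = cong₂ _+_ (cong (λ b → if b then 1 else 0) (p≡q zero))
                                       (countFin-cong (p≡q ∘ suc))

countFin-false : ∀ n → countFin {n} (λ _ → false) ≡ 0
countFin-false zero    = refl
countFin-false (suc n) = countFin-false n

-- An interleaving of a left and a right sequence: an order-preserving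
-- bijection Fin n ≅ Fin a ⊎ Fin b.  Unlike an arbitrary bijection it follows
-- Add, which puts the new vertex first, by a single constructor, and counting
-- along it splits (countFin-split).

data Shuffle : ℕ → ℕ → ℕ → Set where
  []    : Shuffle 0 0 0
  left  : ∀ {n a b} → Shuffle n a b → Shuffle (suc n) (suc a) b
  right : ∀ {n a b} → Shuffle n a b → Shuffle (suc n) a (suc b)

split : ∀ {n a b} → Shuffle n a b → Fin n → Fin a ⊎ Fin b
split (left s)  zero    = inj₁ zero
split (left s)  (suc u) = Sum.map₁ suc (split s u)
split (right s) zero    = inj₂ zero
split (right s) (suc u) = Sum.map₂ suc (split s u)

merge : ∀ {n a b} → Shuffle n a b → Fin a ⊎ Fin b → Fin n
merge (left s)  (inj₁ zero)    = zero
merge (left s)  (inj₁ (suc x)) = suc (merge s (inj₁ x))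
merge (left s)  (inj₂ y)       = suc (merge s (inj₂ y))
merge (right s) (inj₁ x)       = suc (merge s (inj₁ x))
merge (right s) (inj₂ zero)    = zero
merge (right s) (inj₂ (suc y)) = suc (merge s (inj₂ y))

merge-split : ∀ {n a b} (s : Shuffle n a b) u → merge s (split s u) ≡ u
merge-split (left s)  zero    = refl
merge-split (left s)  (suc u) with split s u | merge-split s u
... | inj₁ x | eq = cong suc eq
... | inj₂ y | eq = cong suc eq
merge-split (right s) zero    = refl
merge-split (right s) (suc u) with split s u | merge-split s u
... | inj₁ x | eq = cong suc eq
... | inj₂ y | eq = cong suc eq

split-merge : ∀ {n a b} (s : Shuffle n a b) x → split s (merge s x) ≡ x
split-merge (left s)  (inj₁ zero)    = refl
split-merge (left s)  (inj₁ (suc x)) = cong (Sum.map₁ suc) (split-merge s (inj₁ x))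
split-merge (left s)  (inj₂ y)       = cong (Sum.map₁ suc) (split-merge s (inj₂ y))
split-merge (right s) (inj₁ x)       = cong (Sum.map₂ suc) (split-merge s (inj₁ x))
split-merge (right s) (inj₂ zero)    = refl
split-merge (right s) (inj₂ (suc y)) = cong (Sum.map₂ suc) (split-merge s (inj₂ y))

split↔ : ∀ {n a b} → Shuffle n a b → Fin n ↔ (Fin a ⊎ Fin b)
split↔ s = mk↔ₛ′ (split s) (merge s) (split-merge s) (merge-split s)

split-injective : ∀ {n a b} (s : Shuffle n a b) → Injective _≡_ _≡_ (split s)
split-injective s {u} {v} eq =
  trans (sym (merge-split s u)) (trans (cong (merge s) eq) (merge-split s v))

swap : ∀ {n a b} → Shuffle n a b → Shuffle n b a
swap []        = []
swap (left s)  = right (swap s)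
swap (right s) = left (swap s)

split-swap : ∀ {n a b} (s : Shuffle n a b) u → split (swap s) u ≡ Sum.swap (split s u)
split-swap (left s)  zero    = refl
split-swap (left s)  (suc u) rewrite split-swap s u with split s u
... | inj₁ x = refl
... | inj₂ y = refl
split-swap (right s) zero    = refl
split-swap (right s) (suc u) rewrite split-swap s u with split s u
... | inj₁ x = refl
... | inj₂ y = refl

blocks : ∀ a b → Shuffle (a + b) a b
blocks zero    zero    = []
blocks zero    (suc b) = right (blocks zero b)
blocks (suc a) b       = left (blocks a b)

split-blocks : ∀ a b u → split (blocks a b) u ≡ splitAt a u
split-blocks zero    (suc b) zero    = refl
split-blocks zero    (suc b) (suc u) = cong (Sum.map₂ suc) (split-blocks zero b u)
split-blocks (suc a) b       zero    = refl
split-blocks (suc a) b       (suc u) = cong (Sum.map₁ suc) (split-blocks a b u)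

countFin-split : ∀ {n a b} (s : Shuffle n a b) (q : Fin a ⊎ Fin b → Bool) →
  countFin (q ∘ split s) ≡ countFin (q ∘ inj₁) + countFin (q ∘ inj₂)
countFin-split []        q = refl
countFin-split (left s)  q =
  trans (cong (c +_) (countFin-split s (q ∘ Sum.map₁ suc)))
        (sym (+-assoc c _ _))
  where c = if q (inj₁ zero) then 1 else 0
countFin-split (right s) q =
  trans (cong (c +_) (countFin-split s (q ∘ Sum.map₂ suc)))
        (x∙yz≈y∙xz +-commutativeSemigroup c (countFin (q ∘ inj₁)) _)
  where c = if q (inj₂ zero) then 1 else 0

adj₊ : (G H : Graph) → Fin (size G) ⊎ Fin (size H) → Fin (size G) ⊎ Fin (size H) → Bool
adj₊ G H (inj₁ x) (inj₁ y) = adj G x y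
adj₊ G H (inj₂ x) (inj₂ y) = adj H x y
adj₊ G H (inj₁ x) (inj₂ y) = false
adj₊ G H (inj₂ x) (inj₁ y) = false

adj-⊔ : ∀ G H u v → adj (G ⊔ H) u v ≡ adj₊ G H (splitAt (size G) u) (splitAt (size G) v)
adj-⊔ G H u v with splitAt (size G) u | splitAt (size G) v
... | inj₁ x | inj₁ y = refl
... | inj₁ x | inj₂ y = refl
... | inj₂ x | inj₁ y = refl
... | inj₂ x | inj₂ y = refl

adj₊-swap : ∀ G H x y → adj₊ H G (Sum.swap x) (Sum.swap y) ≡ adj₊ G H x y
adj₊-swap G H (inj₁ x) (inj₁ y) = refl
adj₊-swap G H (inj₁ x) (inj₂ y) = refl
adj₊-swap G H (inj₂ x) (inj₁ y) = refl
adj₊-swap G H (inj₂ x) (inj₂ y) = refl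

adj₊-map : ∀ {G G′ H H′} {f : Fin (size G) → Fin (size G′)} {g : Fin (size H) → Fin (size H′)} →
  (∀ x y → adj G′ (f x) (f y) ≡ adj G x y) → (∀ x y → adj H′ (g x) (g y) ≡ adj H x y) →
  ∀ x y → adj₊ G′ H′ (Sum.map f g x) (Sum.map f g y) ≡ adj₊ G H x y
adj₊-map f-pres g-pres (inj₁ x) (inj₁ y) = f-pres x y
adj₊-map f-pres g-pres (inj₁ x) (inj₂ y) = refl
adj₊-map f-pres g-pres (inj₂ x) (inj₁ y) = refl
adj₊-map f-pres g-pres (inj₂ x) (inj₂ y) = g-pres x y

≅-⊔ : ∀ {X G H} (σ : Fin (size X) ↔ (Fin (size G) ⊎ Fin (size H))) →
  (∀ u v → adj₊ G H (Inverse.to σ u) (Inverse.to σ v) ≡ adj X u v) → X ≅ (G ⊔ H)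
≅-⊔ {X} {G} {H} σ σ-pres = record
  { bij      = ↔-trans σ (↔-sym +↔⊎)
  ; preserve = λ u v → begin
      adj (G ⊔ H) (join′ (to u)) (join′ (to v))
        ≡⟨ adj-⊔ G H (join′ (to u)) (join′ (to v)) ⟩
      adj₊ G H (splitAt′ (join′ (to u))) (splitAt′ (join′ (to v)))
        ≡⟨ cong₂ (adj₊ G H) (splitAt-join (size G) (size H) (to u))
                            (splitAt-join (size G) (size H) (to v)) ⟩
      adj₊ G H (to u) (to v)
        ≡⟨ σ-pres u v ⟩
      adj X u v ∎
  }
  where
    open ≡-Reasoning
    to : Fin (size X) → Fin (size G) ⊎ Fin (size H)
    to = Inverse.to σ
    join′ : Fin (size G) ⊎ Fin (size H) → Fin (size G + size H)
    join′ = join (size G) (size H)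
    splitAt′ : Fin (size G + size H) → Fin (size G) ⊎ Fin (size H)
    splitAt′ = splitAt (size G)

module _ {k kA kB : ℕ} (eA : Fin kA → Fin k) (eB : Fin kB → Fin k) where

  label₊ : (GA : KGraph kA) (GB : KGraph kB) →
    Fin (size (graph GA)) ⊎ Fin (size (graph GB)) → Fin k
  label₊ GA GB = Sum.[ eA ∘ label GA , eB ∘ label GB ]

  record Represents (X : KGraph k) (GA : KGraph kA) (GB : KGraph kB) : Set where
    constructor represents
    field
      shuffle     : Shuffle (size (graph X)) (size (graph GA)) (size (graph GB))
      adj-split   : ∀ u v → adj (graph X) u v
                            ≡ adj₊ (graph GA) (graph GB) (split shuffle u) (split shuffle v)
      label-split : ∀ u → label X u ≡ label₊ GA GB (split shuffle u)

represents-swap : ∀ {k kA kB} {eA : Fin kA → Fin k} {eB : Fin kB → Fin k} {X GA GB} →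
  Represents eA eB X GA GB → Represents eB eA X GB GA
represents-swap {eA = eA} {eB} {X} {GA} {GB} (represents s adj-s label-s) =
  represents (swap s)
    (λ u v → begin
       adj (graph X) u v
         ≡⟨ adj-s u v ⟩
       adj₊ (graph GA) (graph GB) (split s u) (split s v)
         ≡⟨ adj₊-swap (graph GA) (graph GB) (split s u) (split s v) ⟨
       adj₊ (graph GB) (graph GA) (Sum.swap (split s u)) (Sum.swap (split s v))
         ≡⟨ cong₂ (adj₊ (graph GB) (graph GA)) (split-swap s u) (split-swap s v) ⟨
       adj₊ (graph GB) (graph GA) (split (swap s) u) (split (swap s) v) ∎)
    (λ u → trans (label-s u)
                 (trans (label₊-swap (split s u)) (cong (label₊ eB eA GB GA) (sym (split-swap s u)))))
  where
    open ≡-Reasoning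
    label₊-swap : ∀ x → label₊ eA eB GA GB x ≡ label₊ eB eA GB GA (Sum.swap x)
    label₊-swap (inj₁ x) = refl
    label₊-swap (inj₂ y) = refl

represents-≅ : ∀ {k kA kB} {eA : Fin kA → Fin k} {eB : Fin kB → Fin k} {X GA GB A B} →
  Represents eA eB X GA GB → graph GA ≅ A → graph GB ≅ B → graph X ≅ (A ⊔ B)
represents-≅ (represents s adj-s _) GA≅A GB≅B =
  ≅-⊔ (↔-trans (split↔ s) (_≅_.bij GA≅A ⊎-↔ _≅_.bij GB≅B))
      (λ u v → trans (adj₊-map (_≅_.preserve GA≅A) (_≅_.preserve GB≅B) (split s u) (split s v))
                     (sym (adj-s u v)))

liftOp : ∀ {k k′} → (Fin k → Fin k′) → BasicOp k → BasicOp k′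
liftOp e (opAdd i)    = opAdd (e i)
liftOp e (opρ i j)    = opρ (e i) (e j)
liftOp e (opη i j)    = opη (e i) (e j)
liftOp e (opηᵇ b i j) = opηᵇ b (e i) (e j)
liftOp e (opδ i j)    = opδ (e i) (e j)

module Lift {k kA kB : ℕ} (eA : Fin kA → Fin k) (eB : Fin kB → Fin k)
  (eA-injective : Injective _≡_ _≡_ eA) (eB≢eA : ∀ y x → eB y ≢ eA x) where

  module Labelled (GA : KGraph kA) (GB : KGraph kB) where

    labelledA : Fin kA → Fin (size (graph GA)) ⊎ Fin (size (graph GB)) → Bool
    labelledA i = Sum.[ (λ a → label GA a ≡ᵇ i) , (λ _ → false) ]

    label₊-≡ᵇ : ∀ i x → label₊ eA eB GA GB x ≡ᵇ eA i ≡ labelledA i x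
    label₊-≡ᵇ i (inj₁ a) = ⌊≟⌋-injective eA-injective _≟_ _≟_ (label GA a) i
    label₊-≡ᵇ i (inj₂ b) = ⌊≟⌋-≢ _≟_ (eB≢eA (label GB b) i)

  module _ {X GA GB} (r : Represents eA eB X GA GB) where
    open Represents r renaming (shuffle to s)
    open Labelled GA GB

    labelled-split : ∀ i u → label X u ≡ᵇ eA i ≡ labelledA i (split s u)
    labelled-split i u = trans (cong (_≡ᵇ eA i) (label-split u)) (label₊-≡ᵇ i (split s u))

    linked-split : ∀ i j u v →
      linked (λ w → label X w ≡ᵇ eA i) (λ w → label X w ≡ᵇ eA j) u v
      ≡ linked (labelledA i) (labelledA j) (split s u) (split s v)
    linked-split i j =
      linked-cong (labelledA i) (labelledA j) (split s) (labelled-split i) (labelled-split j)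

    sizeLabels-lift : ∀ i j → sizeLabels X (eA i) (eA j) ≡ sizeLabels GA i j
    sizeLabels-lift i j = begin
      sizeLabels X (eA i) (eA j)
        ≡⟨ countFin-cong (λ u → cong₂ _∨_ (labelled-split i u) (labelled-split j u)) ⟩
      countFin (q ∘ split s)
        ≡⟨ countFin-split s q ⟩
      sizeLabels GA i j + countFin {size (graph GB)} (λ _ → false)
        ≡⟨ cong (sizeLabels GA i j +_) (countFin-false (size (graph GB))) ⟩
      sizeLabels GA i j + 0
        ≡⟨ +-identityʳ _ ⟩
      sizeLabels GA i j ∎
      where
        open ≡-Reasoning
        q : Fin (size (graph GA)) ⊎ Fin (size (graph GB)) → Bool
        q x = labelledA i x ∨ labelledA j x

    represents-Add : ∀ i → Represents eA eB (Add (eA i) X) (Add i GA) GB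
    represents-Add i = represents (left s) adj′ label′
      where
        GA′ : Graph
        GA′ = graph (Add i GA)
        new-isolatedˡ : ∀ y → false ≡ adj₊ GA′ (graph GB) (inj₁ zero) y
        new-isolatedˡ (inj₁ y) = refl
        new-isolatedˡ (inj₂ y) = refl
        new-isolatedʳ : ∀ x → false ≡ adj₊ GA′ (graph GB) x (inj₁ zero)
        new-isolatedʳ (inj₁ zero)    = refl
        new-isolatedʳ (inj₁ (suc x)) = refl
        new-isolatedʳ (inj₂ x)       = refl
        adj′ : ∀ u v → adj (graph (Add (eA i) X)) u v
                       ≡ adj₊ GA′ (graph GB) (split (left s) u) (split (left s) v)
        adj′ zero    v       = new-isolatedˡ (split (left s) v)
        adj′ (suc u) zero    = new-isolatedʳ (split (left s) (suc u))
        adj′ (suc u) (suc v) = trans (adj-split u v)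
          (sym (adj₊-map (λ _ _ → refl) (λ _ _ → refl) (split s u) (split s v)))
        label′ : ∀ u → label (Add (eA i) X) u ≡ label₊ eA eB (Add i GA) GB (split (left s) u)
        label′ zero    = refl
        label′ (suc u) = trans (label-split u) (sym ([,]-map (split s u)))

    represents-ρ : ∀ i j → Represents eA eB (ρ (eA i) (eA j) X) (ρ i j GA) GB
    represents-ρ i j = represents s adj-split label′
      where
        relabel : ∀ x → (if labelledA i x then eA j else label₊ eA eB GA GB x)
                        ≡ label₊ eA eB (ρ i j GA) GB x
        relabel (inj₁ a) = sym (if-float eA (label GA a ≡ᵇ i))
        relabel (inj₂ b) = refl
        label′ : ∀ u → label (ρ (eA i) (eA j) X) u ≡ label₊ eA eB (ρ i j GA) GB (split s u)
        label′ u = trans (cong₂ (if_then eA j else_) (labelled-split i u) (label-split u))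
                         (relabel (split s u))

    represents-η : ∀ i j → Represents eA eB (η (eA i) (eA j) X) (η i j GA) GB
    represents-η i j = represents s adj′ label-split
      where
        add-edges : ∀ x y →
          adj₊ (graph GA) (graph GB) x y
            ∨ (linked (labelledA i) (labelledA j) x y ∧ not ⌊ x ≟₊ y ⌋)
          ≡ adj₊ (graph (η i j GA)) (graph GB) x y
        add-edges (inj₁ a) (inj₁ b) =
          cong (λ e → adj (graph GA) a b ∨
                      (linked (labelledA i) (labelledA j) (inj₁ a) (inj₁ b) ∧ not e))
               (⌊≟⌋-injective inj₁-injective _≟_ _≟₊_ a b)
        add-edges (inj₁ a) (inj₂ b) =
          cong (λ c → c ∧ true) (cong₂ _∨_ (∧-zeroʳ (label GA a ≡ᵇ i)) (∧-zeroʳ (label GA a ≡ᵇ j)))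
        add-edges (inj₂ a) (inj₁ b) = refl
        add-edges (inj₂ a) (inj₂ b) = ∨-identityʳ (adj (graph GB) a b)
        adj′ : ∀ u v → adj (graph (η (eA i) (eA j) X)) u v
                       ≡ adj₊ (graph (η i j GA)) (graph GB) (split s u) (split s v)
        adj′ u v = trans
          (cong₂ _∨_ (adj-split u v)
                     (cong₂ (λ c e → c ∧ not e) (linked-split i j u v)
                            (sym (⌊≟⌋-injective (split-injective s) _≟_ _≟₊_ u v))))
          (add-edges (split s u) (split s v))

    represents-δ : ∀ i j → Represents eA eB (δ (eA i) (eA j) X) (δ i j GA) GB
    represents-δ i j = represents s adj′ label-split
      where
        remove-edges : ∀ x y →
          adj₊ (graph GA) (graph GB) x y ∧ not (linked (labelledA i) (labelledA j) x y)
          ≡ adj₊ (graph (δ i j GA)) (graph GB) x y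
        remove-edges (inj₁ a) (inj₁ b) = refl
        remove-edges (inj₁ a) (inj₂ b) = refl
        remove-edges (inj₂ a) (inj₁ b) = refl
        remove-edges (inj₂ a) (inj₂ b) = ∧-identityʳ (adj (graph GB) a b)
        adj′ : ∀ u v → adj (graph (δ (eA i) (eA j) X)) u v
                       ≡ adj₊ (graph (δ i j GA)) (graph GB) (split s u) (split s v)
        adj′ u v = trans (cong₂ (λ a c → a ∧ not c) (adj-split u v) (linked-split i j u v))
                         (remove-edges (split s u) (split s v))

    represents-ηᵇ : ∀ b i j → Represents eA eB (ηᵇ b (eA i) (eA j) X) (ηᵇ b i j GA) GB
    represents-ηᵇ b i j with sizeLabels X (eA i) (eA j) ≤? b | sizeLabels GA i j ≤? b
    ... | yes _   | yes _    = represents-η i j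
    ... | no  _   | no  _    = r
    ... | yes X≤b | no  GA≰b = ⊥-elim (GA≰b (subst (_≤ b) (sizeLabels-lift i j) X≤b))
    ... | no  X≰b | yes GA≤b = ⊥-elim (X≰b (subst (_≤ b) (sym (sizeLabels-lift i j)) GA≤b))

  represents-applyBasic : ∀ o {X GA GB} → Represents eA eB X GA GB →
    Represents eA eB (applyBasic (liftOp eA o) X) (applyBasic o GA) GB
  represents-applyBasic (opAdd i)    r = represents-Add r i
  represents-applyBasic (opρ i j)    r = represents-ρ r i j
  represents-applyBasic (opη i j)    r = represents-η r i j
  represents-applyBasic (opηᵇ b i j) r = represents-ηᵇ r b i j
  represents-applyBasic (opδ i j)    r = represents-δ r i j

  represents-apply : ∀ F {X GA GB} → Represents eA eB X GA GB →
    Represents eA eB (apply (map (liftOp eA) F) X) (apply F GA) GB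
  represents-apply []      r = r
  represents-apply (o ∷ F) r = represents-applyBasic o (represents-apply F r)

apply-++ : ∀ {k} (F F′ : ElemOp k) X → apply (F ++ F′) X ≡ apply F (apply F′ X)
apply-++ []      F′ X = refl
apply-++ (o ∷ F) F′ X = cong (applyBasic o) (apply-++ F F′ X)

↑ʳ≢↑ˡ : ∀ {m n} (y : Fin n) (x : Fin m) → m ↑ʳ y ≢ x ↑ˡ n
↑ʳ≢↑ˡ {m} {n} y x eq
  with () ← trans (sym (splitAt-↑ʳ m n y)) (trans (cong (splitAt m) eq) (splitAt-↑ˡ m x n))

module Juxtaposition (kA kB : ℕ) where

  eA : Fin kA → Fin (kA + kB)
  eA = _↑ˡ kB

  eB : Fin kB → Fin (kA + kB)
  eB = kA ↑ʳ_

  module LiftA = Lift eA eB (↑ˡ-injective kB _ _) ↑ʳ≢↑ˡ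
  module LiftB = Lift eB eA (↑ʳ-injective kA _ _) (λ a b → ↑ʳ≢↑ˡ b a ∘ sym)

  _⊕_ : KGraph kA → KGraph kB → KGraph (kA + kB)
  GA ⊕ GB = record
    { graph = graph GA ⊔ graph GB
    ; label = label₊ eA eB GA GB ∘ splitAt (size (graph GA))
    }

  represents-⊕ : ∀ GA GB → Represents eA eB (GA ⊕ GB) GA GB
  represents-⊕ GA GB = represents (blocks a b)
    (λ u v → trans (adj-⊔ (graph GA) (graph GB) u v)
                   (sym (cong₂ (adj₊ (graph GA) (graph GB)) (split-blocks a b u) (split-blocks a b v))))
    (λ u → cong (label₊ eA eB GA GB) (sym (split-blocks a b u)))
    where
      a b : ℕ
      a = size (graph GA)
      b = size (graph GB)

  _⊕ₒ_ : ElemOp kA → ElemOp kB → ElemOp (kA + kB)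
  FA ⊕ₒ FB = map (liftOp eA) FA ++ map (liftOp eB) FB

  represents-apply-⊕ₒ : ∀ FA FB {X GA GB} → Represents eA eB X GA GB →
    Represents eA eB (apply (FA ⊕ₒ FB) X) (apply FA GA) (apply FB GB)
  represents-apply-⊕ₒ FA FB {X} r =
    subst (λ Y → Represents eA eB Y _ _) (sym (apply-++ (map (liftOp eA) FA) (map (liftOp eB) FB) X))
      (LiftA.represents-apply FA (represents-swap (LiftB.represents-apply FB (represents-swap r))))

  represents-iter : ∀ FA FB n {X GA GB} → Represents eA eB X GA GB →
    Represents eA eB (iter (apply (FA ⊕ₒ FB)) n X) (iter (apply FA) n GA) (iter (apply FB) n GB)
  represents-iter FA FB zero    r = r
  represents-iter FA FB (suc n) r = represents-apply-⊕ₒ FA FB (represents-iter FA FB n r)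

  represents-biIter : ∀ HA FA LA HB FB LB GA GB n →
    Represents eA eB (biIterFamily (HA ⊕ₒ HB) (FA ⊕ₒ FB) (LA ⊕ₒ LB) (GA ⊕ GB) n)
                     (biIterFamily HA FA LA GA n) (biIterFamily HB FB LB GB n)
  represents-biIter HA FA LA HB FB LB GA GB zero    = represents-⊕ GA GB
  represents-biIter HA FA LA HB FB LB GA GB (suc n) =
    represents-apply-⊕ₒ HA HB (represents-iter FA FB n
      (represents-apply-⊕ₒ LA LB (represents-biIter HA FA LA HB FB LB GA GB n)))

lemma5p7 : (A B : ℕ → Graph)
    → (BiIterativelyConstructible A → BiIterativelyConstructible B
         → BiIterativelyConstructible (λ n → A n ⊔ B n))
      × (IterativelyConstructible A → IterativelyConstructible B
         → IterativelyConstructible (λ n → A n ⊔ B n))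
lemma5p7 A B = biIterative , iterative
  where
    biIterative : BiIterativelyConstructible A → BiIterativelyConstructible B
                → BiIterativelyConstructible (λ n → A n ⊔ B n)
    biIterative (kA , GA , HA , FA , LA , GA≅A) (kB , GB , HB , FB , LB , GB≅B) =
      kA + kB , GA ⊕ GB , HA ⊕ₒ HB , FA ⊕ₒ FB , LA ⊕ₒ LB ,
      λ n → represents-≅ (represents-biIter HA FA LA HB FB LB GA GB n) (GA≅A n) (GB≅B n)
      where open Juxtaposition kA kB

    iterative : IterativelyConstructible A → IterativelyConstructible B
              → IterativelyConstructible (λ n → A n ⊔ B n)
    iterative (kA , GA , FA , GA≅A) (kB , GB , FB , GB≅B) =
      kA + kB , GA ⊕ GB , FA ⊕ₒ FB ,
      λ n → represents-≅ (represents-iter FA FB n (represents-⊕ GA GB)) (GA≅A n) (GB≅B n)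
      where open Juxtaposition kA kB
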